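{- For all integers $n\ge 4$ and $p$ with $n\le p\le 5\lceil n/2\rceil+3$, and every positive integer $m$, the $m$-th line digraph $L^m(C_n\cdot C_p)$ is a DNA graph.
   Context: All digraphs are finite. For an arc $a=uv$, $u$ is its tail and $v$ its head. The line digraph $L(D)$ has vertex set $A(D)$, with an arc $xy$ iff the head of $x$ equals the tail of $y$; $L^1(D)=L(D)$, $L^{m+1}(D)=L(L^m(D))$. For integers $\alpha>0$, $k>1$, an $(\alpha,k)$-labeling of $D=(V,A)$ assigns to each vertex $x$ a string $(l_1(x),\dots,l_k(x))$ with entries in $\{1,\dots,\alpha\}$, distinct vertices getting distinct strings, such that for all vertices $x,y$: $xy\in A$ iff $l_i(x)=l_{i-1}(y)$ for all $i\in\{2,\dots,k\}$. A DNA graph is a digraph admitting a $(4,k)$-labeling for some integer $k>1$. The $\infty$-digraph $C_n\cdot C_p$ is obtained from a directed cycle of length $n$ and a directed cycle of length $p$, otherwise vertex-disjoint, by identifying one vertex of the first with one vertex of the second. -}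

module Defs where

open import Data.Nat using (ℕ; zero; suc; _<_)
open import Data.Fin using (Fin; zero; suc; toℕ; inject₁; fromℕ)
open import Data.Sum using (_⊎_; inj₁; inj₂)
open import Data.Product using (Σ; _×_; ∃-syntax)
open import Data.Maybe using (Maybe; nothing; just)
open import Data.Unit using (⊤; tt)
open import Function.Bundles using (_⇔_)
open import Function.Definitions using (Injective)
open import Relation.Binary.PropositionalEquality using (_≡_)

record Digraph : Set₁ where
  field
    V    : Set
    A    : Set
    tail : A → V
    head : A → V
open Digraph public

Arc : (D : Digraph) → V D → V D → Set
Arc D x y = Σ (A D) (λ e → (tail D e ≡ x) × (head D e ≡ y))

L : Digraph → Digraph
L D = record
  { V    = A D
  ; A    = Σ (A D) (λ x → Σ (A D) (λ y → head D x ≡ tail D y))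
  ; tail = λ t → Data.Product.proj₁ t
  ; head = λ t → Data.Product.proj₁ (Data.Product.proj₂ t)
  }

-- Iterated line digraph: Lpow m D = L^(m+1) (D)
Lpow : ℕ → Digraph → Digraph
Lpow zero D = L D
Lpow (suc m) D = L (Lpow m D)

-- L^m D for m ≥ 1 (L^0 is taken as D; only used with m ≥ 1)
L^ : ℕ → Digraph → Digraph
L^ zero D = D
L^ (suc m) D = Lpow m D

-- (α,k)-labeling. Labels are strings indexed by Fin k (position j ↔ l_{j+1}),
-- with entries in Fin α (value c ↔ c+1).
record Labeling (α k : ℕ) (D : Digraph) : Set where
  field
    lab   : V D → Fin k → Fin α
    inj   : Injective _≡_ _≡_ lab
    adj   : ∀ x y → Arc D x y ⇔
              (∀ (i j : Fin k) → toℕ i ≡ suc (toℕ j) → lab x i ≡ lab y j)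

IsDNA : Digraph → Set
IsDNA D = ∃[ k ] ((1 < k) × Labeling 4 k D)

-- The ∞-digraph C_(a+1) · C_(b+1). Vertices: nothing = shared vertex,
-- just (inj₁ i) = the other vertices of the first cycle,
-- just (inj₂ i) = the other vertices of the second cycle.
module _ (a b : ℕ) where
  private
    W = Maybe (Fin a ⊎ Fin b)
    c₁ : Fin (suc a) → W
    c₁ zero = nothing
    c₁ (suc i) = just (inj₁ i)
    c₂ : Fin (suc b) → W
    c₂ zero = nothing
    c₂ (suc i) = just (inj₂ i)
    Arcs = (Fin a ⊎ ⊤) ⊎ (Fin b ⊎ ⊤)
    t h : Arcs → W
    t (inj₁ (inj₁ i)) = c₁ (inject₁ i)
    t (inj₁ (inj₂ _)) = c₁ (fromℕ a)
    t (inj₂ (inj₁ i)) = c₂ (inject₁ i)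
    t (inj₂ (inj₂ _)) = c₂ (fromℕ b)
    h (inj₁ (inj₁ i)) = c₁ (suc i)
    h (inj₁ (inj₂ _)) = nothing
    h (inj₂ (inj₁ i)) = c₂ (suc i)
    h (inj₂ (inj₂ _)) = nothing

  InfSuc : Digraph
  InfSuc = record { V = W ; A = Arcs ; tail = t ; head = h }

-- C_n · C_p for n, p ≥ 1
Inf : ℕ → ℕ → Digraph
Inf n p = InfSuc (Data.Nat._∸_ n 1) (Data.Nat._∸_ p 1)

module Submission where

-- A labeling is simple when the digraph moreover has no parallel arcs.  A
-- simple (α,k)-labeling of D lifts to a simple (α,k+1)-labeling of L(D): the
-- arc uv is labelled by the first letter of u's label followed by v's label
-- (LineDigraph).  So it suffices to label C_n·C_p itself over four letters.
-- We do so by two words w₁, w₂ spelled along the two cycles: a vertex gets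
-- the j+1 letters ending at it.  This is a labeling when the words share their
-- first letter, end with j zeros, and the length-j windows separate all
-- vertices but the two last ones (WordLabeling).  For gapped words -- nonzero
-- letters separated by short runs of zeros, every pair of consecutive nonzero
-- letters occurring only once -- a window is determined by its signature (its
-- last one or two nonzero letters), which gives separation (GappedLabeling).
-- Seven families of gapped words cover p ≤ n + 3(n-2); the remaining cases of
-- the range (n ≤ 7) are eight explicit words, checked by evaluation.

open import Defs
open import Data.Nat using (ℕ; zero; suc; _+_; _*_; _∸_; _<_; _≤_; s≤s; z≤n; _<?_; _≤?_; ⌈_/2⌉)
import Data.Nat.Properties as ℕₚ
open import Data.Nat.Tactic.RingSolver using (solve-∀)
open import Data.Bool using (Bool; true; false)
open import Data.Fin using (Fin; zero; suc; toℕ; inject₁; fromℕ; fromℕ<)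
import Data.Fin.Properties as Finₚ
open import Data.List using (List; []; _∷_; _++_; map)
open import Data.List.Relation.Unary.Any using (here; there)
open import Data.List.Relation.Unary.All using (All; []; _∷_; all?; lookup)
open import Data.List.Relation.Unary.AllPairs using (AllPairs; _∷_; allPairs?)
open import Data.List.Membership.Propositional using (_∈_)
open import Data.List.Membership.Propositional.Properties using (∈-++⁺ˡ; ∈-++⁺ʳ; ∈-++⁻; ∈-map⁺)
open import Data.Maybe using (Maybe; nothing; just)
import Data.Maybe.Properties as Maybeₚ
open import Data.Sum using (_⊎_; inj₁; inj₂)
import Data.Sum.Properties as Sumₚ
open import Data.Unit using (tt)
open import Data.Empty using (⊥-elim)
open import Data.Product using (Σ; _×_; _,_; proj₁; proj₂)
import Data.Product.Properties as Productₚ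
open import Function.Bundles using (_⇔_; mk⇔; Equivalence)
open import Relation.Binary.PropositionalEquality
open import Relation.Binary.Definitions using (DecidableEquality; tri<; tri≈; tri>)
open import Relation.Nullary using (¬_; Dec; yes; no)
open import Relation.Nullary.Decidable using (True; toWitness; map′; _×-dec_; _→-dec_; _⊎-dec_; ¬?)
import Axiom.UniquenessOfIdentityProofs as UIP

-- Overlap lab x y: the label of y is the label of x shifted one place to the
-- left; this is the right-hand side of the arc condition of a labeling.
Overlap : ∀ {α k} {X : Set} → (X → Fin k → Fin α) → X → X → Set
Overlap lab x y = ∀ i j → toℕ i ≡ suc (toℕ j) → lab x i ≡ lab y j

-- A labeling of a digraph without parallel arcs.  Injectivity is stated
-- pointwise, which is what the constructions below produce directly.
record SimpleLabeling (α k : ℕ) (D : Digraph) : Set where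
  field
    label          : V D → Fin k → Fin α
    separates      : ∀ x y → (∀ i → label x i ≡ label y i) → x ≡ y
    arc⇔overlap    : ∀ x y → Arc D x y ⇔ Overlap label x y
    noParallelArcs : ∀ e f → tail D e ≡ tail D f → head D e ≡ head D f → e ≡ f

toLabeling : ∀ {α k D} → SimpleLabeling α k D → Labeling α k D
toLabeling σ = record
  { lab = label
  ; inj = λ {x} {y} eq → separates x y (λ i → cong (λ l → l i) eq)
  ; adj = arc⇔overlap }
  where open SimpleLabeling σ

module LineDigraph {α k : ℕ} {D : Digraph} (σ : SimpleLabeling α (suc k) D) where
  open SimpleLabeling σ

  arcLabel : A D → Fin (suc (suc k)) → Fin α
  arcLabel e zero    = label (tail D e) zero
  arcLabel e (suc i) = label (head D e) i

  private
    arcOverlap : ∀ e → Overlap label (tail D e) (head D e)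
    arcOverlap e = Equivalence.to (arc⇔overlap (tail D e) (head D e)) (e , refl , refl)

    tailShift : ∀ e (i : Fin k) → label (tail D e) (suc i) ≡ label (head D e) (inject₁ i)
    tailShift e i = arcOverlap e (suc i) (inject₁ i) (cong suc (sym (Finₚ.toℕ-inject₁ i)))

    _≟V_ : DecidableEquality (V D)
    x ≟V y with Finₚ.all? (λ i → label x i Finₚ.≟ label y i)
    ... | yes same = yes (separates x y same)
    ... | no ¬same = no (λ x≡y → ¬same (λ i → cong (λ z → label z i) x≡y))

  -- the arc label determines the labels of both ends, hence the arc
  arcSeparates : ∀ e f → (∀ i → arcLabel e i ≡ arcLabel f i) → e ≡ f
  arcSeparates e f same = noParallelArcs e f (separates _ _ tails) (separates _ _ (λ i → same (suc i)))
    where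
    tails : ∀ i → label (tail D e) i ≡ label (tail D f) i
    tails zero    = same zero
    tails (suc i) = begin
      label (tail D e) (suc i)    ≡⟨ tailShift e i ⟩
      label (head D e) (inject₁ i) ≡⟨ same (suc (inject₁ i)) ⟩
      label (head D f) (inject₁ i) ≡⟨ sym (tailShift f i) ⟩
      label (tail D f) (suc i)    ∎
      where open ≡-Reasoning

  consecutive⇒overlap : ∀ e f → head D e ≡ tail D f → Overlap arcLabel e f
  consecutive⇒overlap e f h (suc i) zero eq
    rewrite Finₚ.toℕ-injective {i = i} {j = zero} (ℕₚ.suc-injective eq) = cong (λ z → label z zero) h
  consecutive⇒overlap e f h (suc i) (suc j) eq =
    trans (cong (λ z → label z i) h) (arcOverlap f i j (ℕₚ.suc-injective eq))

  overlap⇒consecutive : ∀ e f → Overlap arcLabel e f → head D e ≡ tail D f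
  overlap⇒consecutive e f o = separates _ _ agree
    where
    agree : ∀ i → label (head D e) i ≡ label (tail D f) i
    agree zero    = o (suc zero) zero refl
    agree (suc i) = trans (o (suc (suc i)) (suc (inject₁ i)) (cong (λ z → suc (suc z)) (sym (Finₚ.toℕ-inject₁ i))))
                          (sym (tailShift f i))

  -- L(D) has no parallel arcs, since proofs of equality of vertices are unique
  lineNoParallelArcs : ∀ (e f : A (L D)) → tail (L D) e ≡ tail (L D) f → head (L D) e ≡ head (L D) f → e ≡ f
  lineNoParallelArcs (x , y , p) (.x , .y , q) refl refl =
    cong (λ r → x , y , r) (UIP.Decidable⇒UIP.≡-irrelevant _≟V_ p q)

  lineLabeling : SimpleLabeling α (suc (suc k)) (L D)
  lineLabeling = record
    { label          = arcLabel
    ; separates      = arcSeparates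
    ; arc⇔overlap    = λ e f → mk⇔
        (λ { ((x , y , p) , refl , refl) → consecutive⇒overlap x y p })
        (λ o → (e , f , overlap⇒consecutive e f o) , refl , refl)
    ; noParallelArcs = lineNoParallelArcs }

iteratedLineLabeling : ∀ {α k D} → SimpleLabeling α (suc k) D →
  ∀ m → SimpleLabeling α (suc (suc (m + k))) (Lpow m D)
iteratedLineLabeling σ zero    = LineDigraph.lineLabeling σ
iteratedLineLabeling σ (suc m) = LineDigraph.lineLabeling (iteratedLineLabeling σ m)

iteratedLine-isDNA : ∀ {k D} → SimpleLabeling 4 (suc k) D → ∀ m → 1 ≤ m → IsDNA (L^ m D)
iteratedLine-isDNA {k} σ (suc m) _ = suc (suc (m + k)) , s≤s (s≤s z≤n) , toLabeling (iteratedLineLabeling σ m)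

-- The ∞-digraph C_(a+2)·C_(b+2) has no parallel arcs: the two arcs entering
-- the shared vertex have different tails (this fails when both cycles are
-- loops), and every other vertex has a single entering arc.
inf-noParallelArcs : ∀ a b (e f : A (InfSuc (suc a) (suc b))) →
  tail (InfSuc (suc a) (suc b)) e ≡ tail (InfSuc (suc a) (suc b)) f →
  head (InfSuc (suc a) (suc b)) e ≡ head (InfSuc (suc a) (suc b)) f → e ≡ f
inf-noParallelArcs a b (inj₁ (inj₁ i)) (inj₁ (inj₁ .i)) _  refl = refl
inf-noParallelArcs a b (inj₁ (inj₂ _)) (inj₁ (inj₂ _))  _  _    = refl
inf-noParallelArcs a b (inj₂ (inj₁ i)) (inj₂ (inj₁ .i)) _  refl = refl
inf-noParallelArcs a b (inj₂ (inj₂ _)) (inj₂ (inj₂ _))  _  _    = refl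
inf-noParallelArcs a b (inj₁ (inj₁ _)) (inj₁ (inj₂ _))  _  ()
inf-noParallelArcs a b (inj₁ (inj₁ _)) (inj₂ (inj₁ _))  _  ()
inf-noParallelArcs a b (inj₁ (inj₁ _)) (inj₂ (inj₂ _))  _  ()
inf-noParallelArcs a b (inj₁ (inj₂ _)) (inj₁ (inj₁ _))  _  ()
inf-noParallelArcs a b (inj₁ (inj₂ _)) (inj₂ (inj₁ _))  _  ()
inf-noParallelArcs a b (inj₁ (inj₂ _)) (inj₂ (inj₂ _))  () _
inf-noParallelArcs a b (inj₂ (inj₁ _)) (inj₁ (inj₁ _))  _  ()
inf-noParallelArcs a b (inj₂ (inj₁ _)) (inj₁ (inj₂ _))  _  ()
inf-noParallelArcs a b (inj₂ (inj₁ _)) (inj₂ (inj₂ _))  _  ()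
inf-noParallelArcs a b (inj₂ (inj₂ _)) (inj₁ (inj₁ _))  _  ()
inf-noParallelArcs a b (inj₂ (inj₂ _)) (inj₁ (inj₂ _))  () _
inf-noParallelArcs a b (inj₂ (inj₂ _)) (inj₂ (inj₁ _))  _  ()

-- lookBack w q t: the letter t places before position q of the word w, or the
-- padding letter 0 when this falls before the start of the word.
lookBack : ∀ {α} → (ℕ → Fin (suc α)) → ℕ → ℕ → Fin (suc α)
lookBack w q       zero    = w q
lookBack w zero    (suc t) = zero
lookBack w (suc q) (suc t) = lookBack w q t

lookBack-at : ∀ {α} (w : ℕ → Fin (suc α)) t u → lookBack w (t + u) t ≡ w u
lookBack-at w zero    u = refl
lookBack-at w (suc t) u = lookBack-at w t u

-- The first cycle spells w₁ from the
-- shared vertex (position 0) to its last vertex (position a+1), the second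
-- cycle spells w₂; a vertex is labelled by the j+1 letters ending at it, read
-- cyclically.  The labeling is valid when both words start with the same
-- letter, both end with j zeros (so that reading past the start amounts to
-- zero padding), and the windows of length j of distinct vertices differ,
-- except for the two last vertices, whose windows are all zeros.
module WordLabeling {α : ℕ} (a' b' j' : ℕ) (w₁ w₂ : ℕ → Fin (suc α)) where
  a b j : ℕ
  a = suc a'
  b = suc b'
  j = suc j'

  D : Digraph
  D = InfSuc a b

  window : V D → ℕ → Fin (suc α)
  window nothing          = lookBack w₁ 0
  window (just (inj₁ i)) = lookBack w₁ (suc (toℕ i))
  window (just (inj₂ i)) = lookBack w₂ (suc (toℕ i))

  end₁ end₂ : V D
  end₁ = just (inj₁ (fromℕ a'))
  end₂ = just (inj₂ (fromℕ b'))

  _≈ⱼ_ : V D → V D → Set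
  x ≈ⱼ z = ∀ t → t < j → window x t ≡ window z t

  SameOrEnds : V D → V D → Set
  SameOrEnds x z = x ≡ z ⊎ ((x ≡ end₁ × z ≡ end₂) ⊎ (x ≡ end₂ × z ≡ end₁))

  Separating : Set
  Separating = ∀ x z → x ≈ⱼ z → SameOrEnds x z

  module _ (sameStart : w₁ 0 ≡ w₂ 0)
           (zeroTail₁ : ∀ t → t < j → lookBack w₁ a t ≡ zero)
           (zeroTail₂ : ∀ t → t < j → lookBack w₂ b t ≡ zero)
           (separating : Separating)
           (endsDiffer : ¬ lookBack w₁ a j ≡ lookBack w₂ b j) where

    label : V D → Fin (suc j) → Fin (suc α)
    label x i = window x (j ∸ toℕ i)

    entry : ℕ → Fin (suc j)
    entry t = fromℕ< {j ∸ t} (s≤s (ℕₚ.m∸n≤m j t))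

    label-entry : ∀ x t → t ≤ j → label x (entry t) ≡ window x t
    label-entry x t t≤j = cong (window x) (begin
      j ∸ toℕ (entry t) ≡⟨ cong (j ∸_) (Finₚ.toℕ-fromℕ< (s≤s (ℕₚ.m∸n≤m j t))) ⟩
      j ∸ (j ∸ t)       ≡⟨ ℕₚ.m∸[m∸n]≡n t≤j ⟩
      t                 ∎)
      where open ≡-Reasoning

    arcShift : ∀ e t → t < j → window (head D e) (suc t) ≡ window (tail D e) t
    arcShift (inj₁ (inj₁ zero))    t _  = refl
    arcShift (inj₁ (inj₁ (suc i))) t _  rewrite Finₚ.toℕ-inject₁ i = refl
    arcShift (inj₁ (inj₂ _))       t lt rewrite Finₚ.toℕ-fromℕ a' = sym (zeroTail₁ t lt)
    arcShift (inj₂ (inj₁ zero))    zero    _ = sym sameStart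
    arcShift (inj₂ (inj₁ zero))    (suc t) _ = refl
    arcShift (inj₂ (inj₁ (suc i))) t _  rewrite Finₚ.toℕ-inject₁ i = refl
    arcShift (inj₂ (inj₂ _))       t lt rewrite Finₚ.toℕ-fromℕ b' = sym (zeroTail₂ t lt)

    Shifted : V D → V D → Set
    Shifted x y = ∀ t → t < j → window x t ≡ window y (suc t)

    overlap⇒shifted : ∀ x y → Overlap label x y → Shifted x y
    overlap⇒shifted x y o t t<j = begin
      window x t               ≡⟨ sym (label-entry x t (ℕₚ.<⇒≤ t<j)) ⟩
      label x (entry t)        ≡⟨ o (entry t) (entry (suc t)) entries ⟩
      label y (entry (suc t))  ≡⟨ label-entry y (suc t) t<j ⟩
      window y (suc t)         ∎
      where
      open ≡-Reasoning
      entries : toℕ (entry t) ≡ suc (toℕ (entry (suc t)))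
      entries rewrite Finₚ.toℕ-fromℕ< (s≤s (ℕₚ.m∸n≤m j t))
                    | Finₚ.toℕ-fromℕ< (s≤s (ℕₚ.m∸n≤m j (suc t))) = ℕₚ.+-∸-assoc 1 (ℕₚ.≤-pred t<j)

    shifted⇒overlap : ∀ x y → Shifted x y → Overlap label x y
    shifted⇒overlap x y s i i' eq = trans (s (j ∸ toℕ i) lt) (cong (window y) (sym shift))
      where
      i'<j : toℕ i' < j
      i'<j = subst (_≤ j) eq (ℕₚ.≤-pred (Finₚ.toℕ<n i))
      lt : j ∸ toℕ i < j
      lt rewrite eq = s≤s (ℕₚ.m∸n≤m j' (toℕ i'))
      shift : j ∸ toℕ i' ≡ suc (j ∸ toℕ i)
      shift rewrite eq = ℕₚ.+-∸-assoc 1 (ℕₚ.≤-pred i'<j)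

    arc⇒shifted : ∀ x y → Arc D x y → Shifted x y
    arc⇒shifted .(tail D e) .(head D e) (e , refl , refl) t lt = sym (arcShift e t lt)

    tail₁≢end₁ : ∀ i → ¬ tail D (inj₁ (inj₁ i)) ≡ end₁
    tail₁≢end₁ zero    ()
    tail₁≢end₁ (suc i) eq = Finₚ.fromℕ≢inject₁ (sym (Sumₚ.inj₁-injective (Maybeₚ.just-injective eq)))
    tail₁≢end₂ : ∀ i → ¬ tail D (inj₁ (inj₁ i)) ≡ end₂
    tail₁≢end₂ zero    ()
    tail₁≢end₂ (suc i) ()
    tail₂≢end₁ : ∀ i → ¬ tail D (inj₂ (inj₁ i)) ≡ end₁
    tail₂≢end₁ zero    ()
    tail₂≢end₁ (suc i) ()
    tail₂≢end₂ : ∀ i → ¬ tail D (inj₂ (inj₁ i)) ≡ end₂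
    tail₂≢end₂ zero    ()
    tail₂≢end₂ (suc i) eq = Finₚ.fromℕ≢inject₁ (sym (Sumₚ.inj₂-injective (Maybeₚ.just-injective eq)))

    entering : V D → A D
    entering nothing          = inj₁ (inj₂ tt)
    entering (just (inj₁ i)) = inj₁ (inj₁ i)
    entering (just (inj₂ i)) = inj₂ (inj₁ i)

    entering-head : ∀ y → head D (entering y) ≡ y
    entering-head nothing          = refl
    entering-head (just (inj₁ i)) = refl
    entering-head (just (inj₂ i)) = refl

    samePredecessorWindow : ∀ x y → Shifted x y → x ≈ⱼ tail D (entering y)
    samePredecessorWindow x y s t lt = begin
      window x t                           ≡⟨ s t lt ⟩
      window y (suc t)                     ≡⟨ cong (λ z → window z (suc t)) (sym (entering-head y)) ⟩
      window (head D (entering y)) (suc t) ≡⟨ arcShift (entering y) t lt ⟩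
      window (tail D (entering y)) t       ∎
      where open ≡-Reasoning

    -- conversely, if y's window is x's window shifted then x has the same
    -- length-j window as the predecessor of y, hence is that predecessor
    -- (or, when y is the shared vertex, its other predecessor)
    shifted⇒arc : ∀ x y → Shifted x y → Arc D x y
    shifted⇒arc x y s with separating x (tail D (entering y)) (samePredecessorWindow x y s)
    shifted⇒arc x y               s | inj₁ refl = entering y , refl , entering-head y
    shifted⇒arc x nothing         s | inj₂ (inj₂ (refl , _)) = inj₂ (inj₂ tt) , refl , refl
    shifted⇒arc x (just (inj₁ i)) s | inj₂ (inj₁ (_ , eq)) = ⊥-elim (tail₁≢end₂ i eq)
    shifted⇒arc x (just (inj₁ i)) s | inj₂ (inj₂ (_ , eq)) = ⊥-elim (tail₁≢end₁ i eq)
    shifted⇒arc x (just (inj₂ i)) s | inj₂ (inj₁ (_ , eq)) = ⊥-elim (tail₂≢end₂ i eq)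
    shifted⇒arc x (just (inj₂ i)) s | inj₂ (inj₂ (_ , eq)) = ⊥-elim (tail₂≢end₁ i eq)

    windowsAgree : ∀ {x y} → (∀ i → label x i ≡ label y i) → ∀ t → t ≤ j → window x t ≡ window y t
    windowsAgree {x} {y} same t t≤j = trans (sym (label-entry x t t≤j)) (trans (same (entry t)) (label-entry y t t≤j))

    windowEnd₁ : window end₁ j ≡ lookBack w₁ a j
    windowEnd₁ = cong (λ q → lookBack w₁ (suc q) j) (Finₚ.toℕ-fromℕ a')
    windowEnd₂ : window end₂ j ≡ lookBack w₂ b j
    windowEnd₂ = cong (λ q → lookBack w₂ (suc q) j) (Finₚ.toℕ-fromℕ b')

    -- labels separate: the length-j windows separate all vertices but the
    -- two last ones, and those differ in the letter j
    labelSeparates : ∀ x y → (∀ i → label x i ≡ label y i) → x ≡ y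
    labelSeparates x y same with separating x y (λ t lt → windowsAgree {x} {y} same t (ℕₚ.<⇒≤ lt))
    ... | inj₁ x≡y                  = x≡y
    ... | inj₂ (inj₁ (refl , refl)) =
      ⊥-elim (endsDiffer (trans (sym windowEnd₁) (trans (windowsAgree {x} {y} same j ℕₚ.≤-refl) windowEnd₂)))
    ... | inj₂ (inj₂ (refl , refl)) =
      ⊥-elim (endsDiffer (trans (sym windowEnd₁) (trans (sym (windowsAgree {x} {y} same j ℕₚ.≤-refl)) windowEnd₂)))

    wordLabeling : SimpleLabeling (suc α) (suc j) D
    wordLabeling = record
      { label          = label
      ; separates      = labelSeparates
      ; arc⇔overlap    = λ x y → mk⇔ (λ arc → shifted⇒overlap x y (arc⇒shifted x y arc))
                                     (λ o → shifted⇒arc x y (overlap⇒shifted x y o))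
      ; noParallelArcs = inf-noParallelArcs a' b' }

wordOf : List (Fin 4) → ℕ → Fin 4
wordOf []       _       = zero
wordOf (c ∷ cs) zero    = c
wordOf (c ∷ cs) (suc q) = wordOf cs q

allVertices? : ∀ {a b} {P : Maybe (Fin a ⊎ Fin b) → Set} → (∀ x → Dec (P x)) → Dec (∀ x → P x)
allVertices? P? = map′
  (λ { (p₀ , p₁ , p₂) → λ { nothing → p₀ ; (just (inj₁ i)) → p₁ i ; (just (inj₂ i)) → p₂ i } })
  (λ p → p nothing , (λ i → p (just (inj₁ i))) , (λ i → p (just (inj₂ i))))
  (P? nothing ×-dec Finₚ.all? (λ i → P? (just (inj₁ i))) ×-dec Finₚ.all? (λ i → P? (just (inj₂ i))))

_≟V_ : ∀ {a b} → DecidableEquality (Maybe (Fin a ⊎ Fin b))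
_≟V_ = Maybeₚ.≡-dec (Sumₚ.≡-dec Finₚ._≟_ Finₚ._≟_)

-- For words given by explicit lists, the hypotheses of the word labeling are
-- decidable, so a particular instance is established by evaluation.
module CheckedInstance (a' b' j' : ℕ) (u₁ u₂ : List (Fin 4)) where
  open WordLabeling a' b' j' (wordOf u₁) (wordOf u₂)

  -- the hypotheses of the word labeling, quantifying over Fin j instead of t < j
  Conditions : Set
  Conditions =
    wordOf u₁ 0 ≡ wordOf u₂ 0 ×
    (∀ (t : Fin j) → lookBack (wordOf u₁) a (toℕ t) ≡ zero) ×
    (∀ (t : Fin j) → lookBack (wordOf u₂) b (toℕ t) ≡ zero) ×
    (∀ x z → (∀ (t : Fin j) → window x (toℕ t) ≡ window z (toℕ t)) → SameOrEnds x z) ×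
    ¬ lookBack (wordOf u₁) a j ≡ lookBack (wordOf u₂) b j

  conditions? : Dec Conditions
  conditions? =
    (wordOf u₁ 0 Finₚ.≟ wordOf u₂ 0) ×-dec
    Finₚ.all? (λ t → lookBack (wordOf u₁) a (toℕ t) Finₚ.≟ zero) ×-dec
    Finₚ.all? (λ t → lookBack (wordOf u₂) b (toℕ t) Finₚ.≟ zero) ×-dec
    allVertices? (λ x → allVertices? (λ z →
      Finₚ.all? (λ t → window x (toℕ t) Finₚ.≟ window z (toℕ t)) →-dec
      ((x ≟V z) ⊎-dec (((x ≟V end₁) ×-dec (z ≟V end₂)) ⊎-dec ((x ≟V end₂) ×-dec (z ≟V end₁)))))) ×-dec
    ¬? (lookBack (wordOf u₁) a j Finₚ.≟ lookBack (wordOf u₂) b j)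

  private
    below : ∀ {P : ℕ → Set} → (∀ (t : Fin j) → P (toℕ t)) → ∀ t → t < j → P t
    below {P} p t t<j = subst P (Finₚ.toℕ-fromℕ< t<j) (p (fromℕ< t<j))

  checkedLabeling : True conditions? → SimpleLabeling 4 (suc j) D
  checkedLabeling ok with toWitness ok
  ... | sameStart , zeroTail₁ , zeroTail₂ , separating , endsDiffer =
    wordLabeling sameStart (below zeroTail₁) (below zeroTail₂)
      (λ x z agree → separating x z (λ t → agree (toℕ t) (Finₚ.toℕ<n t))) endsDiffer

-- A gapped word is given by a list of marks (c , g): a letter c followed by
-- g zeros.
Marks : Set
Marks = List (Fin 4 × ℕ)

afterZeros : ℕ → (ℕ → Fin 4) → ℕ → Fin 4
afterZeros zero    w q       = w q
afterZeros (suc g) w zero    = zero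
afterZeros (suc g) w (suc q) = afterZeros g w q

afterZeros-zero : ∀ g w d → d < g → afterZeros g w d ≡ zero
afterZeros-zero (suc g) w zero    _         = refl
afterZeros-zero (suc g) w (suc d) (s≤s d<g) = afterZeros-zero g w d d<g

afterZeros-skip : ∀ g w r → afterZeros g w (g + r) ≡ w r
afterZeros-skip zero    w r = refl
afterZeros-skip (suc g) w r = afterZeros-skip g w r

spell : Marks → ℕ → Fin 4
spell []             q       = zero
spell ((c , g) ∷ ms) zero    = c
spell ((c , g) ∷ ms) (suc q) = afterZeros g (spell ms) q

spelledLength : Marks → ℕ
spelledLength []             = 0
spelledLength ((c , g) ∷ ms) = suc g + spelledLength ms

c0 c1 c2 c3 : Fin 4
c0 = zero
c1 = suc zero
c2 = suc (suc zero)
c3 = suc (suc (suc zero))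

word : Marks → ℕ → Fin 4
word ms zero    = c1
word ms (suc q) = spell ms q

record Occurrence : Set where
  constructor occurrence
  field
    which      : Bool
    pos        : ℕ
    letter     : Fin 4
    gap        : ℕ
    prevLetter : Fin 4
    prevGap    : ℕ
open Occurrence public

occurrences : Bool → ℕ → Fin 4 → ℕ → Marks → List Occurrence
occurrences κ p c' g' []             = []
occurrences κ p c' g' ((c , g) ∷ ms) = occurrence κ p c g c' g' ∷ occurrences κ (p + suc g) c g ms

occurrence-which : ∀ {κ p c' g' ms o} → o ∈ occurrences κ p c' g' ms → which o ≡ κ
occurrence-which {ms = _ ∷ _} (here refl) = refl
occurrence-which {ms = _ ∷ _} (there o∈) = occurrence-which o∈

occurrence-spells : ∀ {κ p c' g'} ms {o} → o ∈ occurrences κ p c' g' ms →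
  Σ ℕ λ r → (pos o ≡ p + r) × (spell ms r ≡ letter o) ×
            (∀ d → d < gap o → spell ms (suc (r + d)) ≡ zero)
occurrence-spells {p = p} ((c , g) ∷ ms) (here refl) =
  0 , sym (ℕₚ.+-identityʳ p) , refl , afterZeros-zero g (spell ms)
occurrence-spells {p = p} ((c , g) ∷ ms) (there o∈) with occurrence-spells ms o∈
... | r , pos≡ , spellsLetter , spellsZeros =
  suc g + r , trans pos≡ (ℕₚ.+-assoc p (suc g) r) ,
  trans (afterZeros-skip g (spell ms) r) spellsLetter ,
  λ d d<gap → begin
    afterZeros g (spell ms) (suc (g + r + d)) ≡⟨ cong (afterZeros g (spell ms)) (reassoc g r d) ⟩
    afterZeros g (spell ms) (g + suc (r + d)) ≡⟨ afterZeros-skip g (spell ms) (suc (r + d)) ⟩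
    spell ms (suc (r + d))                    ≡⟨ spellsZeros d d<gap ⟩
    zero                                      ∎
  where
  open ≡-Reasoning
  reassoc : ∀ g r d → suc (g + r + d) ≡ g + suc (r + d)
  reassoc = solve-∀

-- the same facts read in the word, where the marks start at position 1
OccursIn : Marks → Bool → Occurrence → Set
OccursIn ms κ o = o ∈ occurrences κ 1 c1 0 ms

occurrence-letter : ∀ ms {κ o} → OccursIn ms κ o → word ms (pos o) ≡ letter o
occurrence-letter ms o∈ with occurrence-spells ms o∈
... | r , refl , spellsLetter , _ = spellsLetter

occurrence-zeros : ∀ ms {κ o} → OccursIn ms κ o → ∀ d → d < gap o → word ms (suc (pos o + d)) ≡ zero
occurrence-zeros ms o∈ d d<gap with occurrence-spells ms o∈
... | r , refl , _ , spellsZeros = spellsZeros d d<gap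

occurrence-predecessor : ∀ {κ p c' g'} ms {o} → o ∈ occurrences κ p c' g' ms →
  (pos o ≡ p × prevLetter o ≡ c' × prevGap o ≡ g') ⊎
  Σ Occurrence λ o' → (o' ∈ occurrences κ p c' g' ms) ×
    (pos o' + suc (gap o') ≡ pos o) × (letter o' ≡ prevLetter o) × (gap o' ≡ prevGap o)
occurrence-predecessor ((c , g) ∷ ms) (here refl) = inj₁ (refl , refl , refl)
occurrence-predecessor {κ} {p} {c'} {g'} ((c , g) ∷ ms) (there o∈) with occurrence-predecessor ms o∈
... | inj₁ (pos≡ , letter≡ , gap≡) = inj₂ (occurrence κ p c g c' g' , here refl , sym pos≡ , sym letter≡ , sym gap≡)
... | inj₂ (o' , o'∈ , follows) = inj₂ (o' , there o'∈ , follows)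

occurrence-covering : ∀ {κ p c' g'} ms q → p ≤ q → q < p + spelledLength ms →
  Σ Occurrence λ o → (o ∈ occurrences κ p c' g' ms) × (pos o ≤ q) × (q ≤ pos o + gap o)
occurrence-covering {p = p} [] q p≤q q<p =
  ⊥-elim (ℕₚ.<-irrefl refl (ℕₚ.<-≤-trans q<p (ℕₚ.≤-trans (ℕₚ.≤-reflexive (ℕₚ.+-identityʳ p)) p≤q)))
occurrence-covering {κ} {p} {c'} {g'} ((c , g) ∷ ms) q p≤q q<end with q ≤? p + g
... | yes q≤ = occurrence κ p c g c' g' , here refl , p≤q , q≤
... | no q≰ with occurrence-covering ms q
                   (subst (_≤ q) (sym (ℕₚ.+-suc p g)) (ℕₚ.≰⇒> q≰))
                   (subst (q <_) (sym (ℕₚ.+-assoc p (suc g) (spelledLength ms))) q<end)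
...   | o , o∈ , lower , upper = o , there o∈ , lower , upper

lastLetter : Fin 4 → Marks → Fin 4
lastLetter c' []             = c'
lastLetter _  ((c , g) ∷ ms) = lastLetter c ms

lastGap : ℕ → Marks → ℕ
lastGap g' []             = g'
lastGap _  ((c , g) ∷ ms) = lastGap g ms

occurrences-snoc : ∀ κ p c' g' ms c g →
  occurrences κ p c' g' (ms ++ (c , g) ∷ []) ≡
  occurrences κ p c' g' ms ++ occurrence κ (p + spelledLength ms) c g (lastLetter c' ms) (lastGap g' ms) ∷ []
occurrences-snoc κ p c' g' [] c g rewrite ℕₚ.+-identityʳ p = refl
occurrences-snoc κ p c' g' ((c₀ , g₀) ∷ ms) c g
  rewrite occurrences-snoc κ (p + suc g₀) c₀ g₀ ms c g | ℕₚ.+-assoc p (suc g₀) (spelledLength ms) = refl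

spelledLength-snoc : ∀ ms c g → spelledLength (ms ++ (c , g) ∷ []) ≡ spelledLength ms + suc g
spelledLength-snoc []             c g = ℕₚ.+-identityʳ (suc g)
spelledLength-snoc ((c₀ , g₀) ∷ ms) c g rewrite spelledLength-snoc ms c g =
  sym (ℕₚ.+-assoc (suc g₀) (spelledLength ms) (suc g))

record Reads (w : ℕ → Fin 4) (d : ℕ) (c : Fin 4) (g : ℕ) (c' : Fin 4) : Set where
  field
    before  : ∀ t → t < d → w t ≡ zero
    at      : w d ≡ c
    between : ∀ t → d < t → t ≤ d + g → w t ≡ zero
    next    : w (suc (d + g)) ≡ c'

occurrence-reads : ∀ ms {κ o} → OccursIn ms κ o → ∀ d → d ≤ gap o →
  Reads (lookBack (word ms) (pos o + d)) d (letter o) (prevGap o) (prevLetter o)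
occurrence-reads ms {o = o} o∈ d d≤gap = record
  { before = before ; at = at ; between = between ; next = next }
  where
  w = word ms

  shiftBefore : ∀ p t e → p + (suc t + e) ≡ t + suc (p + e)
  shiftBefore = solve-∀
  shiftBetween : ∀ p u e d → p + suc (suc u + e) + d ≡ suc (d + u) + suc (p + e)
  shiftBetween = solve-∀
  shiftNext : ∀ p g d → p + suc g + d ≡ suc (d + g) + p
  shiftNext = solve-∀

  before : ∀ t → t < d → lookBack w (pos o + d) t ≡ zero
  before t t<d with ℕₚ.m≤n⇒∃[o]m+o≡n t<d
  ... | e , refl rewrite shiftBefore (pos o) t e | lookBack-at w t (suc (pos o + e)) =
    occurrence-zeros ms o∈ e (ℕₚ.<-≤-trans (s≤s (ℕₚ.m≤n+m e t)) d≤gap)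

  at : lookBack w (pos o + d) d ≡ letter o
  at rewrite ℕₚ.+-comm (pos o) d | lookBack-at w d (pos o) = occurrence-letter ms o∈

  -- these are the gap zeros of the predecessor (the initial letter has no gap)
  between : ∀ t → d < t → t ≤ d + prevGap o → lookBack w (pos o + d) t ≡ zero
  between t d<t t≤ with ℕₚ.m≤n⇒∃[o]m+o≡n d<t
  ... | u , refl with ℕₚ.+-cancelˡ-≤ d (suc u) (prevGap o) (subst (_≤ d + prevGap o) (sym (ℕₚ.+-suc d u)) t≤)
                    | occurrence-predecessor ms o∈
  ... | u<prevGap | inj₁ (_ , _ , prevGap≡0) = ⊥-elim (ℕₚ.≤⇒≯ (subst (suc u ≤_) prevGap≡0 u<prevGap) (s≤s z≤n))
  ... | u<prevGap | inj₂ (o' , o'∈ , follows , _ , gap≡) with ℕₚ.m≤n⇒∃[o]m+o≡n (subst (suc u ≤_) (sym gap≡) u<prevGap)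
  ...   | e , gap≡' rewrite sym follows | sym gap≡' | shiftBetween (pos o') u e d
                          | lookBack-at w (suc (d + u)) (suc (pos o' + e)) =
    occurrence-zeros ms o'∈ e (subst (e <_) gap≡' (s≤s (ℕₚ.m≤n+m e u)))

  next : lookBack w (pos o + d) (suc (d + prevGap o)) ≡ prevLetter o
  next with occurrence-predecessor ms o∈
  ... | inj₁ (pos≡ , letter≡ , gap≡) rewrite pos≡ | gap≡ | ℕₚ.+-identityʳ d =
    trans (cong (λ q → lookBack w q d) (sym (ℕₚ.+-identityʳ d))) (trans (lookBack-at w d 0) (sym letter≡))
  ... | inj₂ (o' , o'∈ , follows , letter≡ , gap≡) rewrite sym follows | sym gap≡ | shiftNext (pos o') (gap o') d
                                                         | lookBack-at w (suc (d + gap o')) (pos o') =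
    trans (occurrence-letter ms o'∈) letter≡

-- The signature of a word read backwards: the distance d to its first nonzero
-- letter c and, when visible, the gap g and the nonzero letter c' after it.
data Signature : Set where
  twoMarks : ℕ → Fin 4 → ℕ → Fin 4 → Signature
  oneMark  : ℕ → Fin 4 → Signature
  noMark   : Signature

module Signatures (j : ℕ) where
  Shows : (ℕ → Fin 4) → Signature → Set
  Shows w (twoMarks d c g c') = Reads w d c g c' × ¬ c ≡ zero × ¬ c' ≡ zero × suc (d + g) < j
  Shows w (oneMark d c)       = (∀ t → t < d → w t ≡ zero) × w d ≡ c × ¬ c ≡ zero ×
                                (∀ t → d < t → t < j → w t ≡ zero) × d < j
  Shows w noMark              = ∀ t → t < j → w t ≡ zero

  end<j⇒d<j : ∀ {d g} → suc (d + g) < j → d < j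
  end<j⇒d<j {d} {g} end<j = ℕₚ.≤-<-trans (ℕₚ.≤-trans (ℕₚ.m≤m+n d g) (ℕₚ.n≤1+n _)) end<j

  shows-transport : ∀ {w w'} → (∀ t → t < j → w t ≡ w' t) → ∀ s → Shows w' s → Shows w s
  shows-transport same (twoMarks d c g c') (reads , c≢0 , c'≢0 , end<j) =
    record { before  = λ t t<d → trans (same t (ℕₚ.<-trans t<d d<j)) (Reads.before reads t t<d)
           ; at      = trans (same d d<j) (Reads.at reads)
           ; between = λ t d<t t≤ → trans (same t (ℕₚ.≤-<-trans t≤ (ℕₚ.<-trans (ℕₚ.n<1+n _) end<j)))
                                          (Reads.between reads t d<t t≤)
           ; next    = trans (same _ end<j) (Reads.next reads) } ,
    c≢0 , c'≢0 , end<j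
    where
    d<j : d < j
    d<j = end<j⇒d<j end<j
  shows-transport same (oneMark d c) (before , at , c≢0 , after , d<j) =
    (λ t t<d → trans (same t (ℕₚ.<-trans t<d d<j)) (before t t<d)) , trans (same d d<j) at , c≢0 ,
    (λ t d<t t<j → trans (same t t<j) (after t d<t t<j)) , d<j
  shows-transport same noMark zeros = λ t t<j → trans (same t t<j) (zeros t t<j)

  private
    firstNonzero : ∀ (w : ℕ → Fin 4) {d d'} → (∀ t → t < d → w t ≡ zero) → ¬ w d ≡ zero →
                   (∀ t → t < d' → w t ≡ zero) → ¬ w d' ≡ zero → d ≡ d'
    firstNonzero w {d} {d'} zeros nz zeros' nz' with ℕₚ.<-cmp d d'
    ... | tri< d<d' _ _ = ⊥-elim (nz (zeros' d d<d'))
    ... | tri≈ _ d≡d' _ = d≡d'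
    ... | tri> _ _ d'<d = ⊥-elim (nz' (zeros d' d'<d))

    nonzero : ∀ {x c : Fin 4} → x ≡ c → ¬ c ≡ zero → ¬ x ≡ zero
    nonzero x≡c c≢0 x≡0 = c≢0 (trans (sym x≡c) x≡0)

    gapZeros : ∀ {w d c g c'} → Reads w d c g c' → ∀ t → t < g → w (suc (d + t)) ≡ zero
    gapZeros {d = d} {g = g} reads t t<g =
      Reads.between reads _ (s≤s (ℕₚ.m≤m+n d t)) (subst (_≤ d + g) (ℕₚ.+-suc d t) (ℕₚ.+-monoʳ-≤ d t<g))

  shows-unique : ∀ w s s' → Shows w s → Shows w s' → s ≡ s'
  shows-unique w (twoMarks d c g e) (twoMarks d' c' g' e') (r , c≢0 , e≢0 , _) (r' , c'≢0 , e'≢0 , _)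
    with firstNonzero w (Reads.before r) (nonzero (Reads.at r) c≢0) (Reads.before r') (nonzero (Reads.at r') c'≢0)
  ... | refl with firstNonzero (λ u → w (suc (d + u))) (gapZeros r) (nonzero (Reads.next r) e≢0)
                                                      (gapZeros r') (nonzero (Reads.next r') e'≢0)
  ... | refl = cong₂ (λ c e → twoMarks d c g e) (trans (sym (Reads.at r)) (Reads.at r'))
                                                 (trans (sym (Reads.next r)) (Reads.next r'))
  shows-unique w (twoMarks d c g e) (oneMark d' c') (r , c≢0 , e≢0 , end<j) (before' , at' , c'≢0 , after' , _)
    with firstNonzero w (Reads.before r) (nonzero (Reads.at r) c≢0) before' (nonzero at' c'≢0)
  ... | refl = ⊥-elim (nonzero (Reads.next r) e≢0 (after' _ (s≤s (ℕₚ.m≤m+n d g)) end<j))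
  shows-unique w (oneMark d c) (twoMarks d' c' g' e') (before , at , c≢0 , after , _) (r' , c'≢0 , e'≢0 , end<j)
    with firstNonzero w before (nonzero at c≢0) (Reads.before r') (nonzero (Reads.at r') c'≢0)
  ... | refl = ⊥-elim (nonzero (Reads.next r') e'≢0 (after _ (s≤s (ℕₚ.m≤m+n d g')) end<j))
  shows-unique w (oneMark d c) (oneMark d' c') (before , at , c≢0 , _) (before' , at' , c'≢0 , _)
    with firstNonzero w before (nonzero at c≢0) before' (nonzero at' c'≢0)
  ... | refl = cong (oneMark d) (trans (sym at) at')
  shows-unique w (twoMarks d c g e) noMark (r , c≢0 , _ , end<j) zeros =
    ⊥-elim (nonzero (Reads.at r) c≢0 (zeros d (end<j⇒d<j end<j)))
  shows-unique w (oneMark d c) noMark (_ , at , c≢0 , _ , d<j) zeros = ⊥-elim (nonzero at c≢0 (zeros d d<j))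
  shows-unique w noMark (twoMarks d c g e) zeros (r , c≢0 , _ , end<j) =
    ⊥-elim (nonzero (Reads.at r) c≢0 (zeros d (end<j⇒d<j end<j)))
  shows-unique w noMark (oneMark d c) zeros (_ , at , c≢0 , _ , d<j) = ⊥-elim (nonzero at c≢0 (zeros d d<j))
  shows-unique w noMark noMark _ _ = refl

  signature-determined : ∀ {w w'} → (∀ t → t < j → w t ≡ w' t) → ∀ s s' → Shows w s → Shows w' s' → s ≡ s'
  signature-determined {w} same s s' shows shows' = shows-unique w s s' shows (shows-transport same s' shows')

key : Occurrence → Fin 4 × Fin 4
key o = letter o , prevLetter o

key-injective : ∀ {os o o'} → AllPairs (λ u v → ¬ u ≡ v) (map key os) → o ∈ os → o' ∈ os → key o ≡ key o' → o ≡ o'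
key-injective (_ ∷ _)        (here refl) (here refl) _  = refl
key-injective (distinct ∷ _) (here refl) (there o'∈) eq = ⊥-elim (lookup distinct (∈-map⁺ key o'∈) eq)
key-injective (distinct ∷ _) (there o∈)  (here refl) eq = ⊥-elim (lookup distinct (∈-map⁺ key o∈) (sym eq))
key-injective (_ ∷ rest)     (there o∈)  (there o'∈) eq = key-injective rest o∈ o'∈ eq

-- Word κ spells the marks
-- inner κ followed by its last letter and j = h+2 zeros.  If all letters are
-- nonzero, the keys of all occurrences are distinct, every gap plus the gap
-- before it is at most h, and the last letters differ, then every window of
-- length j of a vertex has a signature which determines the vertex, and the
-- word labeling applies.
module GappedLabeling (h a' b' : ℕ) (inner : Bool → Marks) (lastL : Bool → Fin 4) where
  j : ℕ
  j = suc (suc h)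

  marks : Bool → Marks
  marks κ = inner κ ++ (lastL κ , j) ∷ []

  wordκ : Bool → ℕ → Fin 4
  wordκ κ = word (marks κ)

  innerOccs occs : Bool → List Occurrence
  innerOccs κ = occurrences κ 1 c1 0 (inner κ)
  occs      κ = occurrences κ 1 c1 0 (marks κ)

  lastOcc : Bool → Occurrence
  lastOcc κ = occurrence κ (1 + spelledLength (inner κ)) (lastL κ) j (lastLetter c1 (inner κ)) (lastGap 0 (inner κ))

  allOccs : List Occurrence
  allOccs = occs false ++ occs true

  cycleLength : Bool → ℕ
  cycleLength false = suc a'
  cycleLength true  = suc b'

  open WordLabeling a' b' (suc h) (wordκ false) (wordκ true) hiding (j)
  open Signatures j

  occs-split : ∀ κ → occs κ ≡ innerOccs κ ++ lastOcc κ ∷ []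
  occs-split κ = occurrences-snoc κ 1 c1 0 (inner κ) (lastL κ) j

  lastOcc∈ : ∀ κ → OccursIn (marks κ) κ (lastOcc κ)
  lastOcc∈ κ rewrite occs-split κ = ∈-++⁺ʳ (innerOccs κ) (here refl)

  innerOcc∈ : ∀ κ {o} → o ∈ innerOccs κ → OccursIn (marks κ) κ o
  innerOcc∈ κ o∈ rewrite occs-split κ = ∈-++⁺ˡ o∈

  occ∈all : ∀ κ {o} → o ∈ occs κ → o ∈ allOccs
  occ∈all false o∈ = ∈-++⁺ˡ o∈
  occ∈all true  o∈ = ∈-++⁺ʳ (occs false) o∈

  place : Fin (suc a') ⊎ Fin (suc b') → Bool × ℕ
  place (inj₁ i) = false , suc (toℕ i)
  place (inj₂ i) = true , suc (toℕ i)

  place-injective : ∀ y y' → place y ≡ place y' → y ≡ y'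
  place-injective (inj₁ i) (inj₁ i') eq = cong inj₁ (Finₚ.toℕ-injective (ℕₚ.suc-injective (cong proj₂ eq)))
  place-injective (inj₂ i) (inj₂ i') eq = cong inj₂ (Finₚ.toℕ-injective (ℕₚ.suc-injective (cong proj₂ eq)))

  window-place : ∀ y {κ q} → place y ≡ (κ , q) → ∀ t → window (just y) t ≡ lookBack (wordκ κ) q t
  window-place (inj₁ i) refl t = refl
  window-place (inj₂ i) refl t = refl

  module Proof
    (length : ∀ κ → spelledLength (marks κ) ≡ cycleLength κ)
    (nonzero : All (λ o → (¬ letter o ≡ zero) × (¬ prevLetter o ≡ zero)) allOccs)
    (distinctKeys : AllPairs (λ u v → ¬ u ≡ v) (map key allOccs))
    (innerGaps : ∀ κ → All (λ o → gap o + prevGap o ≤ h) (innerOccs κ))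
    (lastGaps : ∀ κ → lastGap 0 (inner κ) ≤ h)
    (lastDiffer : ¬ lastL false ≡ lastL true) where

    lastOcc-end : ∀ κ → pos (lastOcc κ) + j ≡ cycleLength κ
    lastOcc-end κ = begin
      suc (spelledLength (inner κ)) + j ≡⟨ sym (ℕₚ.+-suc (spelledLength (inner κ)) j) ⟩
      spelledLength (inner κ) + suc j   ≡⟨ sym (spelledLength-snoc (inner κ) (lastL κ) j) ⟩
      spelledLength (marks κ)           ≡⟨ length κ ⟩
      cycleLength κ                     ∎
      where open ≡-Reasoning

    data Location (y : Fin (suc a') ⊎ Fin (suc b')) : Set where
      inInner : ∀ κ o → o ∈ innerOccs κ → ∀ d → d ≤ gap o → place y ≡ (κ , pos o + d) → Location y
      inLast  : ∀ κ d → d ≤ j → place y ≡ (κ , pos (lastOcc κ) + d) → Location y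

    locate : ∀ y → Location y
    locate y = locateAt (proj₁ (place y)) (proj₂ (place y)) refl (bounds y)
      where
      bounds : ∀ y → 1 ≤ proj₂ (place y) × proj₂ (place y) < 1 + spelledLength (marks (proj₁ (place y)))
      bounds (inj₁ i) = s≤s z≤n , s≤s (subst (suc (toℕ i) ≤_) (sym (length false)) (Finₚ.toℕ<n i))
      bounds (inj₂ i) = s≤s z≤n , s≤s (subst (suc (toℕ i) ≤_) (sym (length true)) (Finₚ.toℕ<n i))
      offset≤gap : ∀ {q} o → q ≤ pos o + gap o → q ∸ pos o ≤ gap o
      offset≤gap {q} o q≤end = subst (q ∸ pos o ≤_) (ℕₚ.m+n∸m≡n (pos o) (gap o)) (ℕₚ.∸-monoˡ-≤ (pos o) q≤end)
      atOffset : ∀ {κ q} o → pos o ≤ q → place y ≡ (κ , q) → place y ≡ (κ , pos o + (q ∸ pos o))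
      atOffset {κ} o pos≤q placed = trans placed (cong (κ ,_) (sym (ℕₚ.m+[n∸m]≡n pos≤q)))
      locateAt : ∀ κ q → place y ≡ (κ , q) → 1 ≤ q × q < 1 + spelledLength (marks κ) → Location y
      locateAt κ q placed (lower , upper) with occurrence-covering (marks κ) q lower upper
      ... | o , o∈ , pos≤q , q≤end with ∈-++⁻ (innerOccs κ) (subst (o ∈_) (occs-split κ) o∈)
      ...   | inj₁ o∈inner     = inInner κ o o∈inner (q ∸ pos o) (offset≤gap o q≤end) (atOffset o pos≤q placed)
      ...   | inj₂ (here refl) = inLast κ (q ∸ pos o) (offset≤gap o q≤end) (atOffset o pos≤q placed)

    data Described (y : Fin (suc a') ⊎ Fin (suc b')) : Signature → Set where
      seesTwo  : ∀ o → o ∈ allOccs → ∀ d → place y ≡ (which o , pos o + d) →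
                 Described y (twoMarks d (letter o) (prevGap o) (prevLetter o))
      seesOne  : ∀ κ d → ¬ suc (d + lastGap 0 (inner κ)) < j → place y ≡ (κ , pos (lastOcc κ) + d) →
                 Described y (oneMark d (lastL κ))
      seesNone : ∀ κ → place y ≡ (κ , pos (lastOcc κ) + j) → Described y noMark

    shows-place : ∀ y {κ q} s → place y ≡ (κ , q) → Shows (lookBack (wordκ κ) q) s → Shows (window (just y)) s
    shows-place y s placed = shows-transport (λ t _ → window-place y placed t) s

    seeingTwo : ∀ y κ o → OccursIn (marks κ) κ o → ∀ d → d ≤ gap o → suc (d + prevGap o) < j →
                place y ≡ (κ , pos o + d) → Σ Signature λ s → Shows (window (just y)) s × Described y s
    seeingTwo y κ o o∈ d d≤gap fits placed =
      twoMarks d (letter o) (prevGap o) (prevLetter o) ,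
      shows-place y (twoMarks d (letter o) (prevGap o) (prevLetter o)) placed
        (occurrence-reads (marks κ) o∈ d d≤gap , proj₁ nz , proj₂ nz , fits) ,
      seesTwo o (occ∈all κ o∈) d (subst (λ κ' → place y ≡ (κ' , pos o + d)) (sym (occurrence-which o∈)) placed)
      where
      nz = lookup nonzero (occ∈all κ o∈)

    signatureOf : ∀ y → Σ Signature λ s → Shows (window (just y)) s × Described y s
    signatureOf y with locate y
    ... | inInner κ o o∈ d d≤gap placed =
      seeingTwo y κ o (innerOcc∈ κ o∈) d d≤gap
        (s≤s (s≤s (ℕₚ.≤-trans (ℕₚ.+-monoˡ-≤ (prevGap o) d≤gap) (lookup (innerGaps κ) o∈)))) placed
    ... | inLast κ d d≤j placed with suc (d + lastGap 0 (inner κ)) <? j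
    ...   | yes fits = seeingTwo y κ (lastOcc κ) (lastOcc∈ κ) d d≤j fits placed
    ...   | no ¬fits with d <? j
    ...     | yes d<j = oneMark d (lastL κ) ,
      shows-place y (oneMark d (lastL κ)) placed
        (Reads.before reads , Reads.at reads , proj₁ (lookup nonzero (occ∈all κ (lastOcc∈ κ))) ,
         (λ t d<t t<j → Reads.between reads t d<t (ℕₚ.≤-pred (ℕₚ.≤-trans t<j (ℕₚ.≮⇒≥ ¬fits)))) , d<j) ,
      seesOne κ d ¬fits placed
      where reads = occurrence-reads (marks κ) (lastOcc∈ κ) d d≤j
    ...     | no d≮j = noMark ,
      shows-place y noMark placed (λ t t<j → Reads.before reads t (ℕₚ.<-≤-trans t<j (ℕₚ.≮⇒≥ d≮j))) ,
      seesNone κ (trans placed (cong (λ d → κ , pos (lastOcc κ) + d) (ℕₚ.≤-antisym d≤j (ℕₚ.≮⇒≥ d≮j))))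
      where reads = occurrence-reads (marks κ) (lastOcc∈ κ) d d≤j

    twoMarks-injective : ∀ {d c g e d' c' g' e'} → twoMarks d c g e ≡ twoMarks d' c' g' e' →
                         d ≡ d' × c ≡ c' × g ≡ g' × e ≡ e'
    twoMarks-injective refl = refl , refl , refl , refl

    oneMark-injective : ∀ {d c d' c'} → oneMark d c ≡ oneMark d' c' → d ≡ d' × c ≡ c'
    oneMark-injective refl = refl , refl

    lastL-injective : ∀ {κ κ'} → lastL κ ≡ lastL κ' → κ ≡ κ'
    lastL-injective {false} {false} _  = refl
    lastL-injective {true}  {true}  _  = refl
    lastL-injective {false} {true}  eq = ⊥-elim (lastDiffer eq)
    lastL-injective {true}  {false} eq = ⊥-elim (lastDiffer (sym eq))

    endOf : Bool → V D
    endOf false = end₁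
    endOf true  = end₂

    atEnd : ∀ y κ → place y ≡ (κ , pos (lastOcc κ) + j) → just y ≡ endOf κ
    atEnd y false placed = cong just (place-injective y (inj₁ (fromℕ a'))
      (trans placed (cong (false ,_) (trans (lastOcc-end false) (cong suc (sym (Finₚ.toℕ-fromℕ a')))))))
    atEnd y true  placed = cong just (place-injective y (inj₂ (fromℕ b'))
      (trans placed (cong (true ,_) (trans (lastOcc-end true) (cong suc (sym (Finₚ.toℕ-fromℕ b')))))))

    sameSignature : ∀ {y y' s s'} → Described y s → Described y' s' → s ≡ s' → SameOrEnds (just y) (just y')
    sameSignature (seesTwo o o∈ d placed) (seesTwo o' o'∈ d' placed') eq with twoMarks-injective eq
    ... | refl , letters , _ , prevLetters with key-injective distinctKeys o∈ o'∈ (cong₂ _,_ letters prevLetters)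
    ...   | refl = inj₁ (cong just (place-injective _ _ (trans placed (sym placed'))))
    sameSignature (seesOne κ d _ placed) (seesOne κ' d' _ placed') eq with oneMark-injective eq
    ... | refl , lasts with lastL-injective lasts
    ...   | refl = inj₁ (cong just (place-injective _ _ (trans placed (sym placed'))))
    sameSignature (seesNone κ placed) (seesNone κ' placed') _ with atEnd _ κ placed | atEnd _ κ' placed'
    sameSignature (seesNone false _) (seesNone false _) _ | y≡ | y'≡ = inj₁ (trans y≡ (sym y'≡))
    sameSignature (seesNone true  _) (seesNone true  _) _ | y≡ | y'≡ = inj₁ (trans y≡ (sym y'≡))
    sameSignature (seesNone false _) (seesNone true  _) _ | y≡ | y'≡ = inj₂ (inj₁ (y≡ , y'≡))
    sameSignature (seesNone true  _) (seesNone false _) _ | y≡ | y'≡ = inj₂ (inj₂ (y≡ , y'≡))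
    sameSignature (seesTwo _ _ _ _)  (seesOne _ _ _ _) ()
    sameSignature (seesTwo _ _ _ _)  (seesNone _ _)    ()
    sameSignature (seesOne _ _ _ _)  (seesTwo _ _ _ _) ()
    sameSignature (seesOne _ _ _ _)  (seesNone _ _)    ()
    sameSignature (seesNone _ _)     (seesTwo _ _ _ _) ()
    sameSignature (seesNone _ _)     (seesOne _ _ _ _) ()

    -- the shared vertex sees the initial letter 1 followed by zeros, a
    -- signature no other vertex has, as the last gaps are short
    shared-shows : Shows (window nothing) (oneMark 0 c1)
    shared-shows = (λ _ ()) , refl , (λ ()) , zerosAfter , s≤s z≤n
      where
      zerosAfter : ∀ t → 0 < t → t < j → window nothing t ≡ zero
      zerosAfter (suc t) _ _ = refl

    notShared : ∀ {y s} → Described y s → ¬ oneMark 0 c1 ≡ s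
    notShared (seesTwo _ _ _ _)      ()
    notShared (seesNone _ _)         ()
    notShared (seesOne κ d ¬fits _) eq =
      ¬fits (subst (λ d → suc (d + lastGap 0 (inner κ)) < j) (proj₁ (oneMark-injective eq)) (s≤s (s≤s (lastGaps κ))))

    separating : Separating
    separating nothing  nothing   _     = inj₁ refl
    separating nothing  (just y') agree with signatureOf y'
    ... | s' , shows' , described' =
      ⊥-elim (notShared described' (signature-determined agree _ s' shared-shows shows'))
    separating (just y) nothing   agree with signatureOf y
    ... | s , shows , described =
      ⊥-elim (notShared described (signature-determined (λ t t<j → sym (agree t t<j)) _ s shared-shows shows))
    separating (just y) (just y') agree with signatureOf y | signatureOf y'
    ... | s , shows , described | s' , shows' , described' =
      sameSignature described described' (signature-determined agree s s' shows shows')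

    lastReads : ∀ κ → Reads (lookBack (wordκ κ) (cycleLength κ)) j (lastL κ) (lastGap 0 (inner κ)) (lastLetter c1 (inner κ))
    lastReads κ = subst (λ q → Reads (lookBack (wordκ κ) q) j _ _ _) (lastOcc-end κ)
                        (occurrence-reads (marks κ) (lastOcc∈ κ) j ℕₚ.≤-refl)

    gappedLabeling : SimpleLabeling 4 (suc j) D
    gappedLabeling = wordLabeling refl (Reads.before (lastReads false)) (Reads.before (lastReads true)) separating
      (λ eq → lastDiffer (trans (sym (Reads.at (lastReads false))) (trans eq (Reads.at (lastReads true)))))

-- A family of labelings of C_(h+4)·C_(b'+2): the first cycle spells 1 2 0^j,
-- the second spells 1, the marks ms, the letter c and 0^j (j = h+2).  The
-- conditions on letters are checked by evaluation, those on gaps by hand.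
module Family (h b' : ℕ) (ms : Marks) (c : Fin 4) where
  inner : Bool → Marks
  inner false = []
  inner true  = ms

  lastL : Bool → Fin 4
  lastL false = c2
  lastL true  = c

  open GappedLabeling h (suc (suc h)) b' inner lastL

  nonzero? : Dec (All (λ o → (¬ letter o ≡ zero) × (¬ prevLetter o ≡ zero)) allOccs)
  nonzero? = all? (λ o → ¬? (letter o Finₚ.≟ zero) ×-dec ¬? (prevLetter o Finₚ.≟ zero)) allOccs

  distinct? : Dec (AllPairs (λ u v → ¬ u ≡ v) (map key allOccs))
  distinct? = allPairs? (λ u v → ¬? (Productₚ.≡-dec Finₚ._≟_ Finₚ._≟_ u v)) (map key allOccs)

  familyLabeling : spelledLength (marks true) ≡ suc b' → All (λ o → gap o + prevGap o ≤ h) (innerOccs true) →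
                   lastGap 0 ms ≤ h → True nonzero? → True distinct? → ¬ c2 ≡ c →
                   SimpleLabeling 4 (suc j) (InfSuc (suc (suc (suc h))) (suc b'))
  familyLabeling length₂ gaps₂ lastGap₂ nonzero distinct lastDiffer =
    Proof.gappedLabeling length (toWitness nonzero) (toWitness distinct) innerGaps lastGaps lastDiffer
    where
    length : ∀ κ → spelledLength (marks κ) ≡ cycleLength κ
    length false = cong suc (ℕₚ.+-identityʳ _)
    length true  = length₂
    innerGaps : ∀ κ → All (λ o → gap o + prevGap o ≤ h) (innerOccs κ)
    innerGaps false = []
    innerGaps true  = gaps₂
    lastGaps : ∀ κ → lastGap 0 (inner κ) ≤ h
    lastGaps false = z≤n
    lastGaps true  = lastGap₂

-- Labelled h r: C_n·C_(n+r) with n = h+4 has a simple labeling over four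
-- letters, with labels of some length.
Labelled : ℕ → ℕ → Set
Labelled h r = Σ ℕ λ k → SimpleLabeling 4 (suc k) (InfSuc (suc (suc (suc h))) (suc (suc (suc h) + r)))

gap+0≤ : ∀ {g h} → g ≤ h → g + 0 ≤ h
gap+0≤ {g} g≤h = subst (_≤ _) (sym (ℕₚ.+-identityʳ g)) g≤h

-- Seven families cover 0 ≤ r ≤ 3j: for q = 0, 1, 2 full periods of length j,
-- either nothing or one more mark with a short gap v ≤ h, and finally r = 3j.
-- Every consecutive pair of letters occurs at most once in both words.
family₀ : ∀ h → Labelled h 0
family₀ h = _ , Family.familyLabeling h (suc (suc h) + 0) [] c3 refl [] z≤n _ _ (λ ())

family₀⁺ : ∀ h g → g ≤ h → Labelled h (suc g)
family₀⁺ h g g≤h = _ , Family.familyLabeling h (suc (suc h) + suc g) ((c1 , g) ∷ []) c3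
  (length h g) (gap+0≤ g≤h ∷ []) g≤h _ _ (λ ())
  where
  length : ∀ h g → suc g + (suc (suc (suc h)) + 0) ≡ suc (suc (suc h) + suc g)
  length = solve-∀

family₁ : ∀ h → Labelled h (suc (suc h) + 0)
family₁ h = _ , Family.familyLabeling h (suc (suc h) + (suc (suc h) + 0)) ((c1 , h) ∷ (c3 , 0) ∷ []) c3
  (length h) (gap+0≤ ℕₚ.≤-refl ∷ ℕₚ.≤-refl ∷ []) z≤n _ _ (λ ())
  where
  length : ∀ h → suc h + (suc 0 + (suc (suc (suc h)) + 0)) ≡ suc (suc (suc h) + (suc (suc h) + 0))
  length = solve-∀

family₁⁺ : ∀ h v → v ≤ h → Labelled h (suc (suc h) + suc v)
family₁⁺ h v v≤h = _ , Family.familyLabeling h (suc (suc h) + (suc (suc h) + suc v)) ((c1 , h) ∷ (c3 , 0) ∷ (c3 , v) ∷ []) c1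
  (length h v) (gap+0≤ ℕₚ.≤-refl ∷ ℕₚ.≤-refl ∷ gap+0≤ v≤h ∷ []) v≤h _ _ (λ ())
  where
  length : ∀ h v → suc h + (suc 0 + (suc v + (suc (suc (suc h)) + 0))) ≡ suc (suc (suc h) + (suc (suc h) + suc v))
  length = solve-∀

family₂ : ∀ h → Labelled h (suc (suc h) + (suc (suc h) + 0))
family₂ h = _ , Family.familyLabeling h (suc (suc h) + (suc (suc h) + (suc (suc h) + 0)))
  ((c1 , h) ∷ (c3 , 0) ∷ (c2 , h) ∷ (c2 , 0) ∷ []) c3
  (length h) (gap+0≤ ℕₚ.≤-refl ∷ ℕₚ.≤-refl ∷ gap+0≤ ℕₚ.≤-refl ∷ ℕₚ.≤-refl ∷ []) z≤n _ _ (λ ())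
  where
  length : ∀ h → suc h + (suc 0 + (suc h + (suc 0 + (suc (suc (suc h)) + 0)))) ≡
                 suc (suc (suc h) + (suc (suc h) + (suc (suc h) + 0)))
  length = solve-∀

family₂⁺ : ∀ h v → v ≤ h → Labelled h (suc (suc h) + (suc (suc h) + suc v))
family₂⁺ h v v≤h = _ , Family.familyLabeling h (suc (suc h) + (suc (suc h) + (suc (suc h) + suc v)))
  ((c1 , h) ∷ (c3 , 0) ∷ (c3 , h) ∷ (c2 , 0) ∷ (c2 , v) ∷ []) c3
  (length h v) (gap+0≤ ℕₚ.≤-refl ∷ ℕₚ.≤-refl ∷ gap+0≤ ℕₚ.≤-refl ∷ ℕₚ.≤-refl ∷ gap+0≤ v≤h ∷ []) v≤h _ _ (λ ())
  where
  length : ∀ h v → suc h + (suc 0 + (suc h + (suc 0 + (suc v + (suc (suc (suc h)) + 0))))) ≡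
                   suc (suc (suc h) + (suc (suc h) + (suc (suc h) + suc v)))
  length = solve-∀

family₃ : ∀ h → Labelled h (suc (suc h) + (suc (suc h) + (suc (suc h) + 0)))
family₃ h = _ , Family.familyLabeling h (suc (suc h) + (suc (suc h) + (suc (suc h) + (suc (suc h) + 0))))
  ((c1 , h) ∷ (c3 , 0) ∷ (c3 , h) ∷ (c2 , 0) ∷ (c2 , h) ∷ (c3 , 0) ∷ []) c1
  (length h) (gap+0≤ ℕₚ.≤-refl ∷ ℕₚ.≤-refl ∷ gap+0≤ ℕₚ.≤-refl ∷ ℕₚ.≤-refl ∷ gap+0≤ ℕₚ.≤-refl ∷ ℕₚ.≤-refl ∷ []) z≤n _ _ (λ ())
  where
  length : ∀ h → suc h + (suc 0 + (suc h + (suc 0 + (suc h + (suc 0 + (suc (suc (suc h)) + 0)))))) ≡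
                 suc (suc (suc h) + (suc (suc h) + (suc (suc h) + (suc (suc h) + 0))))
  length = solve-∀

-- The sporadic cases: C_n·C_p with n ≤ 7 and p beyond n + 3(n-2), labelled by
-- explicit words (n, then p letters) whose conditions are checked by evaluation.
C₄·C₁₁ : Labelled 0 7
C₄·C₁₁ = _ , CheckedInstance.checkedLabeling 2 9 1 (c1 ∷ c1 ∷ c0 ∷ c0 ∷ [])
  (c1 ∷ c2 ∷ c0 ∷ c2 ∷ c1 ∷ c3 ∷ c2 ∷ c2 ∷ c3 ∷ c0 ∷ c0 ∷ []) _

C₄·C₁₂ : Labelled 0 8
C₄·C₁₂ = _ , CheckedInstance.checkedLabeling 2 10 1 (c1 ∷ c1 ∷ c0 ∷ c0 ∷ [])
  (c1 ∷ c2 ∷ c0 ∷ c2 ∷ c1 ∷ c3 ∷ c2 ∷ c2 ∷ c3 ∷ c3 ∷ c0 ∷ c0 ∷ []) _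

C₄·C₁₃ : Labelled 0 9
C₄·C₁₃ = _ , CheckedInstance.checkedLabeling 2 11 2 (c1 ∷ c0 ∷ c0 ∷ c0 ∷ [])
  (c1 ∷ c1 ∷ c0 ∷ c1 ∷ c2 ∷ c0 ∷ c0 ∷ c2 ∷ c0 ∷ c3 ∷ c0 ∷ c0 ∷ c0 ∷ []) _

C₅·C₁₅ : Labelled 1 10
C₅·C₁₅ = _ , CheckedInstance.checkedLabeling 3 13 2 (c1 ∷ c1 ∷ c0 ∷ c0 ∷ c0 ∷ [])
  (c1 ∷ c0 ∷ c1 ∷ c2 ∷ c0 ∷ c0 ∷ c2 ∷ c0 ∷ c1 ∷ c3 ∷ c0 ∷ c3 ∷ c0 ∷ c0 ∷ c0 ∷ []) _

C₅·C₁₆ : Labelled 1 11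
C₅·C₁₆ = _ , CheckedInstance.checkedLabeling 3 14 2 (c1 ∷ c1 ∷ c0 ∷ c0 ∷ c0 ∷ [])
  (c1 ∷ c0 ∷ c1 ∷ c2 ∷ c0 ∷ c0 ∷ c2 ∷ c0 ∷ c1 ∷ c3 ∷ c0 ∷ c2 ∷ c3 ∷ c0 ∷ c0 ∷ c0 ∷ []) _

C₅·C₁₇ : Labelled 1 12
C₅·C₁₇ = _ , CheckedInstance.checkedLabeling 3 15 2 (c1 ∷ c1 ∷ c0 ∷ c0 ∷ c0 ∷ [])
  (c1 ∷ c0 ∷ c1 ∷ c2 ∷ c0 ∷ c0 ∷ c2 ∷ c0 ∷ c1 ∷ c3 ∷ c0 ∷ c2 ∷ c2 ∷ c3 ∷ c0 ∷ c0 ∷ c0 ∷ []) _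

C₅·C₁₈ : Labelled 1 13
C₅·C₁₈ = _ , CheckedInstance.checkedLabeling 3 16 2 (c1 ∷ c1 ∷ c0 ∷ c0 ∷ c0 ∷ [])
  (c1 ∷ c0 ∷ c1 ∷ c2 ∷ c0 ∷ c0 ∷ c2 ∷ c0 ∷ c1 ∷ c3 ∷ c0 ∷ c2 ∷ c1 ∷ c0 ∷ c3 ∷ c0 ∷ c0 ∷ c0 ∷ []) _

C₇·C₂₃ : Labelled 3 16
C₇·C₂₃ = _ , CheckedInstance.checkedLabeling 5 21 2 (c1 ∷ c0 ∷ c0 ∷ c2 ∷ c0 ∷ c0 ∷ c0 ∷ [])
  (c1 ∷ c1 ∷ c0 ∷ c1 ∷ c2 ∷ c0 ∷ c1 ∷ c3 ∷ c0 ∷ c2 ∷ c1 ∷ c0 ∷ c2 ∷ c2 ∷ c0 ∷ c2 ∷ c3 ∷ c0 ∷ c3 ∷ c3 ∷ c0 ∷ c0 ∷ c0 ∷ []) _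

Admissible : ℕ → ℕ → Set
Admissible h r = 4 + h + r ≤ 5 * ⌈ 4 + h /2⌉ + 3

twoHalves≤ : ∀ n → ⌈ n /2⌉ + ⌈ n /2⌉ ≤ suc n
twoHalves≤ n = ℕₚ.≤-trans (ℕₚ.+-monoʳ-≤ ⌈ n /2⌉ (ℕₚ.⌊n/2⌋≤⌈n/2⌉ (suc n))) (ℕₚ.≤-reflexive (ℕₚ.⌊n/2⌋+⌈n/2⌉≡n (suc n)))

tooLarge : ∀ k x → ¬ suc k + x ≤ k
tooLarge k x le = ℕₚ.≤⇒≯ le (s≤s (ℕₚ.m≤m+n k x))

-- for n ≥ 8 the range of the theorem ends at or below n + 3j: doubling the
-- bound p ≤ 5⌈n/2⌉ + 3 gives 2p ≤ 5(n + 1) + 6, while 2(n + 3j + 1) is larger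
beyondRange : ∀ h' x → ¬ Admissible (4 + h') (6 + h' + (6 + h' + (6 + h' + suc x)))
beyondRange h' x adm = tooLarge (5 * suc n + 6) (2 + 3 * h' + 2 * x) (subst (_≤ 5 * suc n + 6) (doubled h' x) (begin
  p + p                             ≤⟨ ℕₚ.+-mono-≤ adm adm ⟩
  (5 * c + 3) + (5 * c + 3)         ≡⟨ regroup c ⟩
  5 * (c + c) + 6                   ≤⟨ ℕₚ.+-monoˡ-≤ 6 (ℕₚ.*-monoʳ-≤ 5 (twoHalves≤ n)) ⟩
  5 * suc n + 6                     ∎))
  where
  open ℕₚ.≤-Reasoning
  n = 8 + h'
  c = ⌈ n /2⌉
  p = n + (6 + h' + (6 + h' + (6 + h' + suc x)))
  regroup : ∀ c → (5 * c + 3) + (5 * c + 3) ≡ 5 * (c + c) + 6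
  regroup = solve-∀
  doubled : ∀ h' x → (8 + h' + (6 + h' + (6 + h' + (6 + h' + suc x)))) + (8 + h' + (6 + h' + (6 + h' + (6 + h' + suc x))))
                     ≡ suc (5 * suc (8 + h') + 6) + (2 + 3 * h' + 2 * x)
  doubled = solve-∀

-- Beyond r = 3j, only the sporadic cases remain in the range.
beyondFamilies : ∀ h x → Admissible h (suc (suc h) + (suc (suc h) + (suc (suc h) + suc x))) →
                 Labelled h (suc (suc h) + (suc (suc h) + (suc (suc h) + suc x)))
beyondFamilies 0 0                   _   = C₄·C₁₁
beyondFamilies 0 1                   _   = C₄·C₁₂
beyondFamilies 0 2                   _   = C₄·C₁₃
beyondFamilies 0 (suc (suc (suc x))) adm = ⊥-elim (tooLarge 13 x adm)
beyondFamilies 1 0                   _   = C₅·C₁₅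
beyondFamilies 1 1                   _   = C₅·C₁₆
beyondFamilies 1 2                   _   = C₅·C₁₇
beyondFamilies 1 3                   _   = C₅·C₁₈
beyondFamilies 1 (suc (suc (suc (suc x)))) adm = ⊥-elim (tooLarge 18 x adm)
beyondFamilies 2 x                   adm = ⊥-elim (tooLarge 18 x adm)
beyondFamilies 3 0                   _   = C₇·C₂₃
beyondFamilies 3 (suc x)             adm = ⊥-elim (tooLarge 23 x adm)
beyondFamilies (suc (suc (suc (suc h')))) x adm = ⊥-elim (beyondRange h' x adm)

data PeriodSplit (h : ℕ) : ℕ → Set where
  empty  : PeriodSplit h 0
  short  : ∀ g → g ≤ h → PeriodSplit h (suc g)
  period : ∀ r → PeriodSplit h (suc (suc h) + r)

periodSplit : ∀ h r → PeriodSplit h r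
periodSplit h zero    = empty
periodSplit h (suc g) with g ≤? h
... | yes g≤h = short g g≤h
... | no  g≰h = subst (PeriodSplit h) (ℕₚ.m+[n∸m]≡n (s≤s (ℕₚ.≰⇒> g≰h))) (period (suc g ∸ suc (suc h)))

labelled : ∀ h r → Admissible h r → Labelled h r
labelled h r adm with periodSplit h r
... | empty       = family₀ h
... | short g g≤h = family₀⁺ h g g≤h
... | period r₁ with periodSplit h r₁
...   | empty       = family₁ h
...   | short v v≤h = family₁⁺ h v v≤h
...   | period r₂ with periodSplit h r₂
...     | empty          = family₂ h
...     | short v v≤h    = family₂⁺ h v v≤h
...     | period zero    = family₃ h
...     | period (suc x) = beyondFamilies h x adm

corollary2 : ∀ (n p m : ℕ) → 4 ≤ n → n ≤ p → p ≤ 5 * ⌈ n /2⌉ + 3 → 1 ≤ m →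
    IsDNA (L^ m (Inf n p))
corollary2 .(4 + h) p m (s≤s (s≤s (s≤s (s≤s {n = h} _)))) n≤p p≤bound 1≤m
  with p ∸ (4 + h) | ℕₚ.m+[n∸m]≡n n≤p
... | r | refl = iteratedLine-isDNA (proj₂ (labelled h r p≤bound)) m 1≤m
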